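{- For all $n\ge0$, $$Q_n(t,q)=\frac{\mu_n(i\sqrt q,-i\sqrt q,t)}{(1-q)^n},\qquad R_n(t,q)=\frac{\mu_n(iq,-iq,t)}{(1-q)^n}.$$
   Context: Let $[n]_q=\frac{1-q^n}{1-q}$, let $D,U$ be the linear operators on polynomials in $t$ with $D(t^n)=[n]_qt^{n-1}$, $U(t^n)=t^{n+1}$, and define $Q_n(t,q)=(D+UDU)^n1$, $R_n(t,q)=(D+DUU)^n1$. For sequences $(b_h)_{h\ge0}$, $(\lambda_h)_{h\ge1}$, let $\mathfrak{J}(b_h,\lambda_h)$ be the Jacobi continued fraction $1/(1-b_0z-\lambda_1z^2/(1-b_1z-\lambda_2z^2/(\cdots)))$. For parameters $a,b,c$ set $A_n=\frac1a(1-abq^n)(1-acq^n)$ and $C_n=a(1-q^n)(1-bcq^{n-1})$, and define $\mu_n(a,b,c)$ (the moments of the continuous dual $q$-Hahn polynomials) by $\sum_{n\ge0}\mu_n(a,b,c)z^n=\mathfrak{J}\big(a+\tfrac1a-A_h-C_h,\;A_{h-1}C_h\big)$. -}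

module Defs where

open import Algebra.Bundles using (CommutativeRing)
open import Data.Nat using (ℕ; zero; suc; _∸_)
open import Data.List using (List; []; _∷_)

module _ {c ℓ} (R : CommutativeRing c ℓ) where
  open CommutativeRing R

  infixl 6 _−_
  _−_ : Carrier → Carrier → Carrier
  x − y = x + (- y)

  pow : Carrier → ℕ → Carrier
  pow x zero = 1#
  pow x (suc n) = x * pow x n

  sumTo : (ℕ → Carrier) → ℕ → Carrier
  sumTo f zero = 0#
  sumTo f (suc n) = sumTo f n + f n

  -- q-integer [n]_q = 1 + q + ... + q^(n-1)  (= (1-q^n)/(1-q))
  qint : Carrier → ℕ → Carrier
  qint q n = sumTo (pow q) n

  -- Polynomials in t over R: coefficient lists, constant term first.
  Poly : Set c
  Poly = List Carrier

  _⊕_ : Poly → Poly → Poly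
  [] ⊕ g = g
  (x ∷ f) ⊕ [] = x ∷ f
  (x ∷ f) ⊕ (y ∷ g) = (x + y) ∷ (f ⊕ g)

  Uop : Poly → Poly
  Uop f = 0# ∷ f

  -- D(t^n) = [n]_q t^(n-1); auxiliary: Dfrom q k f treats f as the
  -- coefficients of t^k, t^(k+1), ...
  Dfrom : Carrier → ℕ → Poly → Poly
  Dfrom q k [] = []
  Dfrom q k (x ∷ f) = (qint q k * x) ∷ Dfrom q (suc k) f

  Dop : Carrier → Poly → Poly
  Dop q [] = []
  Dop q (x ∷ f) = Dfrom q 1 f

  iter : (Poly → Poly) → ℕ → Poly → Poly
  iter F zero p = p
  iter F (suc n) p = F (iter F n p)

  evalP : Poly → Carrier → Carrier
  evalP [] t = 0#
  evalP (x ∷ f) t = x + t * evalP f t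

  one : Poly
  one = 1# ∷ []

  -- Q_n(t,q) = (D + UDU)^n 1,  R_n(t,q) = (D + DUU)^n 1, evaluated at t
  Qpoly : Carrier → ℕ → Poly
  Qpoly q n = iter (λ f → Dop q f ⊕ Uop (Dop q (Uop f))) n one

  Rpoly : Carrier → ℕ → Poly
  Rpoly q n = iter (λ f → Dop q f ⊕ Dop q (Uop (Uop f))) n one

  Q : ℕ → Carrier → Carrier → Carrier
  Q n t q = evalP (Qpoly q n) t

  Rn : ℕ → Carrier → Carrier → Carrier
  Rn n t q = evalP (Rpoly q n) t

  -- Formal power series in z over R: coefficient functions.
  Series : Set c
  Series = ℕ → Carrier

  oneS : Series
  oneS zero = 1#
  oneS (suc n) = 0#

  _⊛_ : Series → Series → Series
  (f ⊛ g) n = sumTo (λ k → f k * g (n ∸ k)) (suc n)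

  powS : Series → ℕ → Series
  powS g zero = oneS
  powS g (suc k) = g ⊛ powS g k

  -- 1/(1 - g) for a series g with zero constant term: sum_k g^k
  -- (the coefficient of z^n only receives contributions from k ≤ n)
  inv1m : Series → Series
  inv1m g n = sumTo (λ k → powS g k n) (suc n)

  -- Depth-d truncation of the J-fraction starting at level h:
  --   J 0 h = 1,
  --   J (d+1) h = 1 / (1 - b_h z - λ_{h+1} z^2 J d (h+1)).
  jfracTrunc : (ℕ → Carrier) → (ℕ → Carrier) → ℕ → ℕ → Series
  jfracTrunc b l zero h = oneS
  jfracTrunc b l (suc d) h = inv1m g
    where
    g : Series
    g zero = 0#
    g (suc zero) = b h
    g (suc (suc n)) = l (suc h) * jfracTrunc b l d (suc h) n

  -- n-th coefficient of J(b_h, λ_h); the depth-(n+1) truncation already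
  -- agrees with the infinite J-fraction up to z^(2n+2).
  jfracCoeff : (ℕ → Carrier) → (ℕ → Carrier) → ℕ → Carrier
  jfracCoeff b l n = jfracTrunc b l (suc n) 0 n

  -- Moments of continuous dual q-Hahn polynomials mu_n(a,b,c);
  -- ainv plays the role of 1/a.
  module _ (q a ainv bb cc : Carrier) where
    Aseq : ℕ → Carrier
    Aseq n = ainv * ((1# − a * bb * pow q n) * (1# − a * cc * pow q n))

    -- q^(n-1) at n = 0 is irrelevant since the factor (1 - q^0) vanishes
    Cseq : ℕ → Carrier
    Cseq n = a * ((1# − pow q n) * (1# − bb * cc * pow q (n ∸ 1)))

    bseq : ℕ → Carrier
    bseq h = a + ainv − Aseq h − Cseq h

    -- λ_h = A_{h-1} C_h for h ≥ 1 (λ_0 is never used)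
    lseq : ℕ → Carrier
    lseq zero = 0#
    lseq (suc h) = Aseq h * Cseq (suc h)

    mu : ℕ → Carrier
    mu n = jfracCoeff bseq lseq n

-- Pair a polynomial f with the functionals ψ_k(f) = (D_q^k f)(t) / [k]_q!.  For W = D + UDU (E = 1)
-- and W = D + DUU (E = q) they satisfy a three-term relation
--   (1 − q) ψ_k(W f) = α_k ψ_(k−1)(f) + β_k ψ_k(f) + γ_k ψ_(k+1)(f),
-- so (1 − q)^n ψ_0(W^n 1) = (1 − q)^n (W^n 1)(t) is the total weight of Motzkin paths of length n with
-- weights α, β, γ.  By Flajolet's theorem this is the n-th coefficient of the J-fraction with
-- b_h = β_h and λ_h = α_h γ_(h−1); when a² = −qE (a = i√q, resp. a = iq) these are exactly the
-- coefficients that define μ_n(a, −a, t).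
module Submission where

open import Algebra.Bundles using (CommutativeRing)
import Algebra.Properties.CommutativeSemigroup as CommutativeSemigroupProperties
import Algebra.Properties.Ring as RingProperties
import Algebra.Properties.Semiring.Mult.TCOptimised as Multiples
open import Algebra.Solver.Ring.AlmostCommutativeRing
  using (_-Raw-AlmostCommutative⟶_; fromCommutativeRing)
open import Data.Integer as ℤ using (ℤ; +_; -[1+_]; _⊖_; _◃_)
import Data.Integer.Properties as ℤ
open import Data.List using ([]; _∷_)
open import Data.Maybe using (Maybe; just; nothing)
open import Data.Nat as ℕ using (ℕ; zero; suc; _∸_; _≤_; _<_; z≤n; s≤s)
import Data.Nat.Properties as ℕ
open import Data.Nat.Induction using (<-rec)
open import Data.Product using (_×_; _,_)
import Data.Sign as Sign
open import Data.Sum using (inj₁; inj₂)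
open import Function using (_∘_)
import Relation.Binary.PropositionalEquality as ≡
open import Relation.Nullary using (yes; no)

open import Defs hiding (_−_; _⊕_; _⊛_)
import Defs

-- The ring solver for an arbitrary commutative ring, with integer coefficients so that
-- cancellations such as x − x = 0 are decided.
module ℤ-CoefficientSolver {c ℓ} (R : CommutativeRing c ℓ) where
  open CommutativeRing R hiding (zero)
  open CommutativeSemigroupProperties +-commutativeSemigroup using (interchange)
  open RingProperties ring using (-0#≈0#; -‿involutive; -‿distribˡ-*; -‿distribʳ-*; -‿+-comm)
  open Multiples semiring using (×-homo-+; ×1-homo-*) renaming (_×_ to _×′_)
  open import Relation.Binary.Reasoning.Setoid setoid

  ⟦_⟧ℤ : ℤ → Carrier
  ⟦ + n ⟧ℤ = n ×′ 1#
  ⟦ -[1+ n ] ⟧ℤ = - (suc n ×′ 1#)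

  private
    ⟦+◃⟧ : ∀ n → ⟦ Sign.+ ◃ n ⟧ℤ ≈ n ×′ 1#
    ⟦+◃⟧ zero = refl
    ⟦+◃⟧ (suc n) = refl

    ⟦-◃⟧ : ∀ n → ⟦ Sign.- ◃ n ⟧ℤ ≈ - (n ×′ 1#)
    ⟦-◃⟧ zero = sym -0#≈0#
    ⟦-◃⟧ (suc n) = refl

    ⟦⊖⟧ : ∀ m n → ⟦ m ⊖ n ⟧ℤ ≈ m ×′ 1# + - (n ×′ 1#)
    ⟦⊖⟧ m zero = sym (trans (+-congˡ -0#≈0#) (+-identityʳ _))
    ⟦⊖⟧ zero (suc n) = sym (+-identityˡ _)
    ⟦⊖⟧ (suc m) (suc n) = begin
      ⟦ suc m ⊖ suc n ⟧ℤ                   ≡⟨ ≡.cong ⟦_⟧ℤ (ℤ.[1+m]⊖[1+n]≡m⊖n m n) ⟩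
      ⟦ m ⊖ n ⟧ℤ                           ≈⟨ ⟦⊖⟧ m n ⟩
      m ×′ 1# + - (n ×′ 1#)                ≈⟨ +-identityˡ _ ⟨
      0# + (m ×′ 1# + - (n ×′ 1#))         ≈⟨ +-congʳ (-‿inverseʳ 1#) ⟨
      (1# + - 1#) + (m ×′ 1# + - (n ×′ 1#)) ≈⟨ interchange 1# _ (- 1#) _ ⟨
      (1# + m ×′ 1#) + (- 1# + - (n ×′ 1#)) ≈⟨ +-cong (×-homo-+ 1# 1 m) (sym (-‿+-comm 1# _)) ⟨
      suc m ×′ 1# + - (1# + n ×′ 1#)       ≈⟨ +-congˡ (-‿cong (×-homo-+ 1# 1 n)) ⟨
      suc m ×′ 1# + - (suc n ×′ 1#)        ∎

    ⟦⟧-homo-+ : ∀ i j → ⟦ i ℤ.+ j ⟧ℤ ≈ ⟦ i ⟧ℤ + ⟦ j ⟧ℤ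
    ⟦⟧-homo-+ -[1+ m ] -[1+ n ] = begin
      - (suc (suc (m ℕ.+ n)) ×′ 1#)    ≡⟨ ≡.cong (λ k → - (suc k ×′ 1#)) (ℕ.+-suc m n) ⟨
      - ((suc m ℕ.+ suc n) ×′ 1#)      ≈⟨ -‿cong (×-homo-+ 1# (suc m) (suc n)) ⟩
      - (suc m ×′ 1# + suc n ×′ 1#)    ≈⟨ -‿+-comm _ _ ⟨
      - (suc m ×′ 1#) + - (suc n ×′ 1#) ∎
    ⟦⟧-homo-+ -[1+ m ] (+ n) = trans (⟦⊖⟧ n (suc m)) (+-comm _ _)
    ⟦⟧-homo-+ (+ m) -[1+ n ] = ⟦⊖⟧ m (suc n)
    ⟦⟧-homo-+ (+ m) (+ n) = ×-homo-+ 1# m n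

    ⟦⟧-homo-* : ∀ i j → ⟦ i ℤ.* j ⟧ℤ ≈ ⟦ i ⟧ℤ * ⟦ j ⟧ℤ
    ⟦⟧-homo-* (+ m) (+ n) = trans (⟦+◃⟧ (m ℕ.* n)) (×1-homo-* m n)
    ⟦⟧-homo-* (+ m) -[1+ n ] = begin
      ⟦ Sign.- ◃ m ℕ.* suc n ⟧ℤ    ≈⟨ ⟦-◃⟧ (m ℕ.* suc n) ⟩
      - ((m ℕ.* suc n) ×′ 1#)      ≈⟨ -‿cong (×1-homo-* m (suc n)) ⟩
      - (m ×′ 1# * suc n ×′ 1#)    ≈⟨ -‿distribʳ-* _ _ ⟩
      m ×′ 1# * - (suc n ×′ 1#)    ∎
    ⟦⟧-homo-* -[1+ m ] (+ n) = begin
      ⟦ Sign.- ◃ suc m ℕ.* n ⟧ℤ    ≈⟨ ⟦-◃⟧ (suc m ℕ.* n) ⟩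
      - ((suc m ℕ.* n) ×′ 1#)      ≈⟨ -‿cong (×1-homo-* (suc m) n) ⟩
      - (suc m ×′ 1# * n ×′ 1#)    ≈⟨ -‿distribˡ-* _ _ ⟩
      - (suc m ×′ 1#) * n ×′ 1#    ∎
    ⟦⟧-homo-* -[1+ m ] -[1+ n ] = begin
      (suc m ℕ.* suc n) ×′ 1#            ≈⟨ ×1-homo-* (suc m) (suc n) ⟩
      suc m ×′ 1# * suc n ×′ 1#          ≈⟨ -‿involutive _ ⟨
      - - (suc m ×′ 1# * suc n ×′ 1#)    ≈⟨ -‿cong (-‿distribˡ-* _ _) ⟩
      - (- (suc m ×′ 1#) * suc n ×′ 1#)  ≈⟨ -‿distribʳ-* _ _ ⟩
      - (suc m ×′ 1#) * - (suc n ×′ 1#)  ∎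

    ⟦⟧-homo-neg : ∀ i → ⟦ ℤ.- i ⟧ℤ ≈ - ⟦ i ⟧ℤ
    ⟦⟧-homo-neg (+ zero) = sym -0#≈0#
    ⟦⟧-homo-neg (+ suc n) = refl
    ⟦⟧-homo-neg -[1+ n ] = sym (-‿involutive _)

    ℤ⟶R : ℤ.+-*-rawRing -Raw-AlmostCommutative⟶ fromCommutativeRing R
    ℤ⟶R = record
      { ⟦_⟧ = ⟦_⟧ℤ ; +-homo = ⟦⟧-homo-+ ; *-homo = ⟦⟧-homo-* ; -‿homo = ⟦⟧-homo-neg
      ; 0-homo = refl ; 1-homo = refl }

    _≟⟦⟧_ : ∀ i j → Maybe (⟦ i ⟧ℤ ≈ ⟦ j ⟧ℤ)
    i ≟⟦⟧ j with i ℤ.≟ j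
    ... | yes ≡.refl = just refl
    ... | no _ = nothing

  open import Algebra.Solver.Ring ℤ.+-*-rawRing (fromCommutativeRing R) ℤ⟶R _≟⟦⟧_ public

  :0 :1 : ∀ {n} → Polynomial n
  :0 = con (+ 0)
  :1 = con (+ 1)

module Moments {c ℓ} (R : CommutativeRing c ℓ) where
  open CommutativeRing R hiding (zero)
  open CommutativeSemigroupProperties +-commutativeSemigroup using (interchange)
  open CommutativeSemigroupProperties *-commutativeSemigroup using (x∙yz≈y∙xz)
  open ℤ-CoefficientSolver R using (solve; _:=_; _:+_; _:-_; :-_; _:*_; :0; :1)
  open import Relation.Binary.Reasoning.Setoid setoid

  infixl 6 _−_
  _−_ : Carrier → Carrier → Carrier
  _−_ = Defs._−_ R

  infixr 8 _^_
  _^_ : Carrier → ℕ → Carrier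
  _^_ = pow R

  infixl 6 _⊕_
  _⊕_ : Poly R → Poly R → Poly R
  _⊕_ = Defs._⊕_ R

  infixl 7 _⊛_
  _⊛_ : Series R → Series R → Series R
  _⊛_ = Defs._⊛_ R

  lincomb₁ : ∀ {x y u v} k → u ≈ v → x ≈ y + k * (u − v) → x ≈ y
  lincomb₁ {y = y} k u≈v x≈ = begin
    _                ≈⟨ x≈ ⟩
    y + k * (_ − _)  ≈⟨ +-congˡ (*-congˡ (trans (+-congʳ u≈v) (-‿inverseʳ _))) ⟩
    y + k * 0#       ≈⟨ +-congˡ (zeroʳ k) ⟩
    y + 0#           ≈⟨ +-identityʳ y ⟩
    y                ∎

  lincomb₂ : ∀ {x y u₁ v₁ u₂ v₂} k₁ k₂ → u₁ ≈ v₁ → u₂ ≈ v₂ →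
             x ≈ y + k₁ * (u₁ − v₁) + k₂ * (u₂ − v₂) → x ≈ y
  lincomb₂ k₁ k₂ e₁ e₂ = lincomb₁ k₁ e₁ ∘ lincomb₁ k₂ e₂

  lincomb₃ : ∀ {x y u₁ v₁ u₂ v₂ u₃ v₃} k₁ k₂ k₃ → u₁ ≈ v₁ → u₂ ≈ v₂ → u₃ ≈ v₃ →
             x ≈ y + k₁ * (u₁ − v₁) + k₂ * (u₂ − v₂) + k₃ * (u₃ − v₃) → x ≈ y
  lincomb₃ k₁ k₂ k₃ e₁ e₂ e₃ = lincomb₂ k₁ k₂ e₁ e₂ ∘ lincomb₁ k₃ e₃

  qint-geometric : ∀ q n → (1# − q) * qint R q n ≈ 1# − q ^ n
  qint-geometric q zero = solve 1 (λ q → (:1 :- q) :* :0 := :1 :- :1) refl q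
  qint-geometric q (suc n) = lincomb₁ 1# (qint-geometric q n)
    (solve 3 (λ q S P → (:1 :- q) :* (S :+ P) := (:1 :- (q :* P)) :+ (:1 :* (((:1 :- q) :* S) :- (:1 :- P)))) refl
      q (qint R q n) (q ^ n))

  ^-inverse : ∀ {x y} → x * y ≈ 1# → ∀ n → x ^ n * y ^ n ≈ 1#
  ^-inverse xy≈1 zero = *-identityˡ 1#
  ^-inverse {x} {y} xy≈1 (suc n) = lincomb₂ (x ^ n * y ^ n) 1# xy≈1 (^-inverse xy≈1 n)
    (solve 4 (λ x y X Y → (x :* X) :* (y :* Y) := (:1 :+ ((X :* Y) :* ((x :* y) :- :1))) :+ (:1 :* ((X :* Y) :- :1))) refl
      x y (x ^ n) (y ^ n))

  -- Polynomials paired with coefficient sequences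

  ⟪_∣_⟫ : (ℕ → Carrier) → Poly R → Carrier
  ⟪ c ∣ [] ⟫ = 0#
  ⟪ c ∣ x ∷ f ⟫ = x * c 0 + ⟪ c ∘ suc ∣ f ⟫

  ⟪⟫-cong : ∀ {c d} → (∀ j → c j ≈ d j) → ∀ f → ⟪ c ∣ f ⟫ ≈ ⟪ d ∣ f ⟫
  ⟪⟫-cong c≈d [] = refl
  ⟪⟫-cong c≈d (x ∷ f) = +-cong (*-congˡ (c≈d 0)) (⟪⟫-cong (c≈d ∘ suc) f)

  ⟪⟫-zero : ∀ f → ⟪ (λ _ → 0#) ∣ f ⟫ ≈ 0#
  ⟪⟫-zero [] = refl
  ⟪⟫-zero (x ∷ f) = trans (+-cong (zeroʳ x) (⟪⟫-zero f)) (+-identityʳ 0#)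

  ⟪⟫-+ : ∀ c d f → ⟪ (λ j → c j + d j) ∣ f ⟫ ≈ ⟪ c ∣ f ⟫ + ⟪ d ∣ f ⟫
  ⟪⟫-+ c d [] = sym (+-identityʳ 0#)
  ⟪⟫-+ c d (x ∷ f) =
    trans (+-cong (distribˡ x (c 0) (d 0)) (⟪⟫-+ (c ∘ suc) (d ∘ suc) f)) (interchange _ _ _ _)

  ⟪⟫-* : ∀ x c f → ⟪ (λ j → x * c j) ∣ f ⟫ ≈ x * ⟪ c ∣ f ⟫
  ⟪⟫-* x c [] = sym (zeroʳ x)
  ⟪⟫-* x c (y ∷ f) = begin
    y * (x * c 0) + ⟪ (λ j → x * c (suc j)) ∣ f ⟫  ≈⟨ +-cong (x∙yz≈y∙xz y x (c 0)) (⟪⟫-* x (c ∘ suc) f) ⟩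
    x * (y * c 0) + x * ⟪ c ∘ suc ∣ f ⟫            ≈⟨ distribˡ x _ _ ⟨
    x * ⟪ c ∣ y ∷ f ⟫                              ∎

  ⟪⟫-linear₃ : ∀ x y z a b c f →
               ⟪ (λ j → x * a j + y * b j + z * c j) ∣ f ⟫ ≈ x * ⟪ a ∣ f ⟫ + y * ⟪ b ∣ f ⟫ + z * ⟪ c ∣ f ⟫
  ⟪⟫-linear₃ x y z a b c f = begin
    ⟪ (λ j → x * a j + y * b j + z * c j) ∣ f ⟫
      ≈⟨ ⟪⟫-+ _ _ f ⟩
    ⟪ (λ j → x * a j + y * b j) ∣ f ⟫ + ⟪ (λ j → z * c j) ∣ f ⟫
      ≈⟨ +-cong (⟪⟫-+ _ _ f) (⟪⟫-* z c f) ⟩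
    ⟪ (λ j → x * a j) ∣ f ⟫ + ⟪ (λ j → y * b j) ∣ f ⟫ + z * ⟪ c ∣ f ⟫
      ≈⟨ +-congʳ (+-cong (⟪⟫-* x a f) (⟪⟫-* y b f)) ⟩
    x * ⟪ a ∣ f ⟫ + y * ⟪ b ∣ f ⟫ + z * ⟪ c ∣ f ⟫ ∎

  ⟪⟫-⊕ : ∀ c f g → ⟪ c ∣ f ⊕ g ⟫ ≈ ⟪ c ∣ f ⟫ + ⟪ c ∣ g ⟫
  ⟪⟫-⊕ c [] g = sym (+-identityˡ _)
  ⟪⟫-⊕ c (x ∷ f) [] = sym (+-identityʳ _)
  ⟪⟫-⊕ c (x ∷ f) (y ∷ g) =
    trans (+-cong (distribʳ (c 0) x y) (⟪⟫-⊕ (c ∘ suc) f g)) (interchange _ _ _ _)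

  ⟪⟫-U : ∀ c f → ⟪ c ∣ Uop R f ⟫ ≈ ⟪ c ∘ suc ∣ f ⟫
  ⟪⟫-U c f = trans (+-congʳ (zeroˡ (c 0))) (+-identityˡ _)

  ⟪⟫-Dfrom : ∀ q k c f → ⟪ c ∣ Dfrom R q k f ⟫ ≈ ⟪ (λ j → qint R q (k ℕ.+ j) * c j) ∣ f ⟫
  ⟪⟫-Dfrom q k c [] = refl
  ⟪⟫-Dfrom q k c (x ∷ f) = +-cong head tail
    where
    head : qint R q k * x * c 0 ≈ x * (qint R q (k ℕ.+ 0) * c 0)
    head = begin
      qint R q k * x * c 0          ≈⟨ *-assoc _ x (c 0) ⟩
      qint R q k * (x * c 0)        ≈⟨ x∙yz≈y∙xz _ x (c 0) ⟩
      x * (qint R q k * c 0)        ≡⟨ ≡.cong (λ i → x * (qint R q i * c 0)) (ℕ.+-identityʳ k) ⟨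
      x * (qint R q (k ℕ.+ 0) * c 0) ∎
    tail : ⟪ c ∘ suc ∣ Dfrom R q (suc k) f ⟫ ≈ ⟪ (λ j → qint R q (k ℕ.+ suc j) * c (suc j)) ∣ f ⟫
    tail = trans (⟪⟫-Dfrom q (suc k) (c ∘ suc) f)
      (⟪⟫-cong (λ j → reflexive (≡.cong (λ i → qint R q i * c (suc j)) (≡.sym (ℕ.+-suc k j)))) f)

  D† : Carrier → (ℕ → Carrier) → ℕ → Carrier
  D† q c zero = 0#
  D† q c (suc j) = qint R q (suc j) * c j

  ⟪⟫-D : ∀ q c f → ⟪ c ∣ Dop R q f ⟫ ≈ ⟪ D† q c ∣ f ⟫
  ⟪⟫-D q c [] = refl
  ⟪⟫-D q c (x ∷ f) = trans (⟪⟫-Dfrom q 1 c f) (sym (trans (+-congʳ (zeroʳ x)) (+-identityˡ _)))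

  -- (1 − q) times the transpose, under ⟪_∣_⟫, of D + UDU (E = 1) or of D + DUU (E = q).
  Ŵ : Carrier → Carrier → (ℕ → Carrier) → ℕ → Carrier
  Ŵ q E c zero = (1# − q * E) * c 1
  Ŵ q E c (suc j) = (1# − q ^ suc j) * c j + (1# − q * E * q ^ suc j) * c (suc (suc j))

  Ŵ-transpose : ∀ {q E} (κ : ℕ → Carrier) → (∀ j → (1# − q) * κ j ≈ 1# − q * E * q ^ j) → ∀ c f →
                (1# − q) * (⟪ D† q c ∣ f ⟫ + ⟪ (λ j → κ j * c (suc j)) ∣ f ⟫) ≈ ⟪ Ŵ q E c ∣ f ⟫
  Ŵ-transpose {q} {E} κ κ-spec c f = begin
    (1# − q) * (⟪ D† q c ∣ f ⟫ + ⟪ (λ j → κ j * c (suc j)) ∣ f ⟫)  ≈⟨ *-congˡ (⟪⟫-+ _ _ f) ⟨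
    (1# − q) * ⟪ (λ j → D† q c j + κ j * c (suc j)) ∣ f ⟫          ≈⟨ ⟪⟫-* _ _ f ⟨
    ⟪ (λ j → (1# − q) * (D† q c j + κ j * c (suc j))) ∣ f ⟫        ≈⟨ ⟪⟫-cong pointwise f ⟩
    ⟪ Ŵ q E c ∣ f ⟫                                                ∎
    where
    pointwise : ∀ j → (1# − q) * (D† q c j + κ j * c (suc j)) ≈ Ŵ q E c j
    pointwise zero = lincomb₁ (c 1) (κ-spec 0)
      (solve 4 (λ q E κ c1 → (:1 :- q) :* (:0 :+ (κ :* c1)) := ((:1 :- (q :* E)) :* c1) :+ (c1 :* (((:1 :- q) :* κ) :- (:1 :- ((q :* E) :* :1))))) refl
        q E (κ 0) (c 1))
    pointwise (suc j) = lincomb₂ (c j) (c (suc (suc j))) (qint-geometric q (suc j)) (κ-spec (suc j))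
      (solve 7 (λ q E I κ P c0 c2 → (:1 :- q) :* ((I :* c0) :+ (κ :* c2)) := ((((:1 :- (q :* P)) :* c0) :+ ((:1 :- ((q :* E) :* (q :* P))) :* c2)) :+ (c0 :* (((:1 :- q) :* I) :- (:1 :- (q :* P))))) :+ (c2 :* (((:1 :- q) :* κ) :- (:1 :- ((q :* E) :* (q :* P)))))) refl
        q E (qint R q (suc j)) (κ (suc j)) (q ^ j) (c j) (c (suc (suc j))))

  D+UDU D+DUU : Carrier → Poly R → Poly R
  D+UDU q f = Dop R q f ⊕ Uop R (Dop R q (Uop R f))
  D+DUU q f = Dop R q f ⊕ Dop R q (Uop R (Uop R f))

  D+UDU-transpose : ∀ q c f → (1# − q) * ⟪ c ∣ D+UDU q f ⟫ ≈ ⟪ Ŵ q 1# c ∣ f ⟫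
  D+UDU-transpose q c f = trans (*-congˡ split) (Ŵ-transpose (λ j → qint R q (suc j)) κ-spec c f)
    where
    split : ⟪ c ∣ D+UDU q f ⟫ ≈ ⟪ D† q c ∣ f ⟫ + ⟪ (λ j → qint R q (suc j) * c (suc j)) ∣ f ⟫
    split = trans (⟪⟫-⊕ c (Dop R q f) (Uop R (Dop R q (Uop R f)))) (+-cong (⟪⟫-D q c f) (begin
      ⟪ c ∣ Uop R (Dop R q (Uop R f)) ⟫              ≈⟨ ⟪⟫-U c (Dop R q (Uop R f)) ⟩
      ⟪ c ∘ suc ∣ Dop R q (Uop R f) ⟫                ≈⟨ ⟪⟫-D q (c ∘ suc) (Uop R f) ⟩
      ⟪ D† q (c ∘ suc) ∣ Uop R f ⟫                   ≈⟨ ⟪⟫-U (D† q (c ∘ suc)) f ⟩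
      ⟪ (λ j → qint R q (suc j) * c (suc j)) ∣ f ⟫   ∎))
    κ-spec : ∀ j → (1# − q) * qint R q (suc j) ≈ 1# − q * 1# * q ^ j
    κ-spec j = lincomb₁ 1# (qint-geometric q (suc j))
      (solve 3 (λ q I P → (:1 :- q) :* I := (:1 :- ((q :* :1) :* P)) :+ (:1 :* (((:1 :- q) :* I) :- (:1 :- (q :* P))))) refl
        q (qint R q (suc j)) (q ^ j))

  D+DUU-transpose : ∀ q c f → (1# − q) * ⟪ c ∣ D+DUU q f ⟫ ≈ ⟪ Ŵ q q c ∣ f ⟫
  D+DUU-transpose q c f = trans (*-congˡ split) (Ŵ-transpose (λ j → qint R q (suc (suc j))) κ-spec c f)
    where
    split : ⟪ c ∣ D+DUU q f ⟫ ≈ ⟪ D† q c ∣ f ⟫ + ⟪ (λ j → qint R q (suc (suc j)) * c (suc j)) ∣ f ⟫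
    split = trans (⟪⟫-⊕ c (Dop R q f) (Dop R q (Uop R (Uop R f)))) (+-cong (⟪⟫-D q c f) (begin
      ⟪ c ∣ Dop R q (Uop R (Uop R f)) ⟫                   ≈⟨ ⟪⟫-D q c (Uop R (Uop R f)) ⟩
      ⟪ D† q c ∣ Uop R (Uop R f) ⟫                        ≈⟨ ⟪⟫-U (D† q c) (Uop R f) ⟩
      ⟪ D† q c ∘ suc ∣ Uop R f ⟫                          ≈⟨ ⟪⟫-U (D† q c ∘ suc) f ⟩
      ⟪ (λ j → qint R q (suc (suc j)) * c (suc j)) ∣ f ⟫  ∎))
    κ-spec : ∀ j → (1# − q) * qint R q (suc (suc j)) ≈ 1# − q * q * q ^ j
    κ-spec j = lincomb₁ 1# (qint-geometric q (suc (suc j)))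
      (solve 3 (λ q I P → (:1 :- q) :* I := (:1 :- ((q :* q) :* P)) :+ (:1 :* (((:1 :- q) :* I) :- (:1 :- (q :* (q :* P)))))) refl
        q (qint R q (suc (suc j))) (q ^ j))

  -- Power series and the J-fraction as a sum over Motzkin paths

  sumTo-congᵇ : ∀ {F G} N → (∀ k → k < N → F k ≈ G k) → sumTo R F N ≈ sumTo R G N
  sumTo-congᵇ zero F≈G = refl
  sumTo-congᵇ (suc N) F≈G = +-cong (sumTo-congᵇ N (λ k k<N → F≈G k (ℕ.m<n⇒m<1+n k<N))) (F≈G N ℕ.≤-refl)

  sumTo-zero : ∀ {F} N → (∀ k → k < N → F k ≈ 0#) → sumTo R F N ≈ 0#
  sumTo-zero zero F≈0 = refl
  sumTo-zero (suc N) F≈0 =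
    trans (+-cong (sumTo-zero N (λ k k<N → F≈0 k (ℕ.m<n⇒m<1+n k<N))) (F≈0 N ℕ.≤-refl)) (+-identityʳ 0#)

  sumTo-+ : ∀ F G N → sumTo R (λ k → F k + G k) N ≈ sumTo R F N + sumTo R G N
  sumTo-+ F G zero = sym (+-identityʳ 0#)
  sumTo-+ F G (suc N) = trans (+-congʳ (sumTo-+ F G N)) (interchange _ _ _ _)

  sumTo-* : ∀ x F N → sumTo R (λ k → x * F k) N ≈ x * sumTo R F N
  sumTo-* x F zero = sym (zeroʳ x)
  sumTo-* x F (suc N) = trans (+-congʳ (sumTo-* x F N)) (sym (distribˡ x _ _))

  sumTo-first : ∀ F N → sumTo R F (suc N) ≈ F 0 + sumTo R (F ∘ suc) N
  sumTo-first F zero = +-comm 0# (F 0)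
  sumTo-first F (suc N) = trans (+-congʳ (sumTo-first F N)) (+-assoc _ _ _)

  ⊛-zero : ∀ f g → (f ⊛ g) 0 ≈ f 0 * g 0
  ⊛-zero f g = +-identityˡ _

  ⊛-first : ∀ f g n → (f ⊛ g) (suc n) ≈ f 0 * g (suc n) + ((f ∘ suc) ⊛ g) n
  ⊛-first f g n = sumTo-first _ (suc n)

  ⊛-last : ∀ f g n → (f ⊛ g) (suc n) ≈ (f ⊛ (g ∘ suc)) n + f (suc n) * g 0
  ⊛-last f g n = +-cong
    (sumTo-congᵇ (suc n) (λ k k<1+n → *-congˡ (reflexive (≡.cong g (ℕ.+-∸-assoc 1 (ℕ.≤-pred k<1+n))))))
    (*-congˡ (reflexive (≡.cong g (ℕ.n∸n≡0 n))))

  ⊛-congᵇ : ∀ {f f′ g g′} n → (∀ i → i ≤ n → f i ≈ f′ i) → (∀ i → i ≤ n → g i ≈ g′ i) →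
            (f ⊛ g) n ≈ (f′ ⊛ g′) n
  ⊛-congᵇ n f≈f′ g≈g′ =
    sumTo-congᵇ (suc n) (λ k k<1+n → *-cong (f≈f′ k (ℕ.≤-pred k<1+n)) (g≈g′ (n ∸ k) (ℕ.m∸n≤m n k)))

  ⊛-comm : ∀ f g n → (f ⊛ g) n ≈ (g ⊛ f) n
  ⊛-comm f g zero = trans (⊛-zero f g) (trans (*-comm _ _) (sym (⊛-zero g f)))
  ⊛-comm f g (suc n) = begin
    (f ⊛ g) (suc n)                        ≈⟨ ⊛-first f g n ⟩
    f 0 * g (suc n) + ((f ∘ suc) ⊛ g) n    ≈⟨ +-cong (*-comm _ _) (⊛-comm (f ∘ suc) g n) ⟩
    g (suc n) * f 0 + (g ⊛ (f ∘ suc)) n    ≈⟨ +-comm _ _ ⟩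
    (g ⊛ (f ∘ suc)) n + g (suc n) * f 0    ≈⟨ ⊛-last g f n ⟨
    (g ⊛ f) (suc n)                        ∎

  ⊛-+ʳ : ∀ f g h n → (f ⊛ (λ i → g i + h i)) n ≈ (f ⊛ g) n + (f ⊛ h) n
  ⊛-+ʳ f g h n = trans (sumTo-congᵇ (suc n) (λ k _ → distribˡ (f k) _ _)) (sumTo-+ _ _ (suc n))

  ⊛-*ʳ : ∀ f x g n → (f ⊛ (λ i → x * g i)) n ≈ x * (f ⊛ g) n
  ⊛-*ʳ f x g n = trans (sumTo-congᵇ (suc n) (λ k _ → x∙yz≈y∙xz (f k) x _)) (sumTo-* x _ (suc n))

  ⊛-linear₂ : ∀ f x y g h n → (f ⊛ (λ i → x * g i + y * h i)) n ≈ x * (f ⊛ g) n + y * (f ⊛ h) n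
  ⊛-linear₂ f x y g h n = trans (⊛-+ʳ f (λ i → x * g i) (λ i → y * h i) n) (+-cong (⊛-*ʳ f x g n) (⊛-*ʳ f y h n))

  ⊛-linear₃ : ∀ f x y z g h k n →
              (f ⊛ (λ i → x * g i + y * h i + z * k i)) n ≈ x * (f ⊛ g) n + y * (f ⊛ h) n + z * (f ⊛ k) n
  ⊛-linear₃ f x y z g h k n = trans (⊛-+ʳ f (λ i → x * g i + y * h i) (λ i → z * k i) n) (+-cong (⊛-linear₂ f x y g h n) (⊛-*ʳ f z k n))

  ⊛-sumʳ : ∀ f (F : ℕ → Series R) N n → (f ⊛ (λ i → sumTo R (λ k → F k i) N)) n ≈ sumTo R (λ k → (f ⊛ F k) n) N
  ⊛-sumʳ f F zero n = sumTo-zero (suc n) (λ k _ → zeroʳ (f k))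
  ⊛-sumʳ f F (suc N) n = trans (⊛-+ʳ f (λ i → sumTo R (λ k → F k i) N) (F N) n) (+-congʳ (⊛-sumʳ f F N n))

  module _ {g : Series R} (g₀≈0 : g 0 ≈ 0#) where

    powS-vanish : ∀ k m → m < k → powS R g k m ≈ 0#
    powS-vanish (suc k) m (s≤s m≤k) = sumTo-zero (suc m) term
      where
      term : ∀ i → i < suc m → g i * powS R g k (m ∸ i) ≈ 0#
      term zero _ = trans (*-congʳ g₀≈0) (zeroˡ _)
      term (suc i) (s≤s i<m) =
        trans (*-congˡ (powS-vanish k (m ∸ suc i) (ℕ.<-≤-trans (ℕ.∸-monoʳ-< (s≤s z≤n) i<m) m≤k))) (zeroʳ _)

    inv1m-partial : ∀ N m → m < N → sumTo R (λ k → powS R g k m) N ≈ inv1m R g m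
    inv1m-partial (suc N) m (s≤s m≤N) with ℕ.m≤n⇒m<n∨m≡n m≤N
    ... | inj₁ m<N = trans (+-cong (inv1m-partial N m m<N) (powS-vanish N m m<N)) (+-identityʳ _)
    ... | inj₂ ≡.refl = refl

    inv1m-fixpoint : ∀ m → inv1m R g m ≈ oneS R m + (g ⊛ inv1m R g) m
    inv1m-fixpoint m = begin
      inv1m R g m
        ≈⟨ inv1m-partial (suc (suc m)) m (ℕ.m<n⇒m<1+n (ℕ.n<1+n m)) ⟨
      sumTo R (λ k → powS R g k m) (suc (suc m))
        ≈⟨ sumTo-first _ (suc m) ⟩
      oneS R m + sumTo R (λ k → (g ⊛ powS R g k) m) (suc m)
        ≈⟨ +-congˡ (⊛-sumʳ g (powS R g) (suc m) m) ⟨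
      oneS R m + (g ⊛ (λ j → sumTo R (λ k → powS R g k j) (suc m))) m
        ≈⟨ +-congˡ (⊛-congᵇ m (λ _ _ → refl) (λ j j≤m → inv1m-partial (suc m) j (s≤s j≤m))) ⟩
      oneS R m + (g ⊛ inv1m R g) m ∎

  fixpoint-unique : ∀ {g g′ S T : Series R} N → g 0 ≈ 0# → (∀ i → i ≤ N → g i ≈ g′ i) →
                    (∀ m → m ≤ N → S m ≈ oneS R m + (g ⊛ S) m) →
                    (∀ m → m ≤ N → T m ≈ oneS R m + (g′ ⊛ T) m) →
                    ∀ m → m ≤ N → S m ≈ T m
  fixpoint-unique {g} {g′} {S} {T} N g₀≈0 g≈g′ S-fix T-fix = <-rec _ step
    where
    heads : ∀ x y → g 0 * x ≈ g′ 0 * y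
    heads x y = trans (trans (*-congʳ g₀≈0) (zeroˡ x))
      (sym (trans (*-congʳ (trans (sym (g≈g′ 0 z≤n)) g₀≈0)) (zeroˡ y)))
    step : ∀ m → (∀ {i} → i < m → i ≤ N → S i ≈ T i) → m ≤ N → S m ≈ T m
    step m S≈T m≤N = begin
      S m                    ≈⟨ S-fix m m≤N ⟩
      oneS R m + (g ⊛ S) m   ≈⟨ +-congˡ (convolutions m S≈T m≤N) ⟩
      oneS R m + (g′ ⊛ T) m  ≈⟨ T-fix m m≤N ⟨
      T m                    ∎
      where
      convolutions : ∀ m → (∀ {i} → i < m → i ≤ N → S i ≈ T i) → m ≤ N → (g ⊛ S) m ≈ (g′ ⊛ T) m
      convolutions zero _ _ = trans (⊛-zero g S) (trans (heads (S 0) (T 0)) (sym (⊛-zero g′ T)))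
      convolutions (suc m) S≈T 1+m≤N = begin
        (g ⊛ S) (suc m)                           ≈⟨ ⊛-first g S m ⟩
        g 0 * S (suc m) + ((g ∘ suc) ⊛ S) m       ≈⟨ +-cong (heads _ _) (⊛-congᵇ m
                                                       (λ i i≤m → g≈g′ (suc i) (ℕ.≤-trans (s≤s i≤m) 1+m≤N))
                                                       (λ i i≤m → S≈T (s≤s i≤m) (ℕ.≤-trans (ℕ.m≤n⇒m≤1+n i≤m) 1+m≤N))) ⟩
        g′ 0 * T (suc m) + ((g′ ∘ suc) ⊛ T) m     ≈⟨ ⊛-first g′ T m ⟨
        (g′ ⊛ T) (suc m)                          ∎

  -- Weighted Motzkin paths of length n from height k down to height 0: a step leaving height k
  -- weighs a k going down, b k staying level and c k going up.
  module Motzkin (a b c : ℕ → Carrier) where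

    paths : ℕ → ℕ → Carrier
    paths zero zero = 1#
    paths zero (suc k) = 0#
    paths (suc n) zero = b 0 * paths n 0 + c 0 * paths n 1
    paths (suc n) (suc k) = a (suc k) * paths n k + b (suc k) * paths n (suc k) + c (suc k) * paths n (suc (suc k))

    excursion : Series R
    excursion n = paths n 0

  paths-cong : ∀ {a b c a′ b′ c′} → (∀ k → a k ≈ a′ k) → (∀ k → b k ≈ b′ k) → (∀ k → c k ≈ c′ k) →
               ∀ n k → Motzkin.paths a b c n k ≈ Motzkin.paths a′ b′ c′ n k
  paths-cong a≈ b≈ c≈ zero zero = refl
  paths-cong a≈ b≈ c≈ zero (suc k) = refl
  paths-cong a≈ b≈ c≈ (suc n) zero =
    +-cong (*-cong (b≈ 0) (paths-cong a≈ b≈ c≈ n 0)) (*-cong (c≈ 0) (paths-cong a≈ b≈ c≈ n 1))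
  paths-cong a≈ b≈ c≈ (suc n) (suc k) = +-cong
    (+-cong (*-cong (a≈ (suc k)) (paths-cong a≈ b≈ c≈ n k)) (*-cong (b≈ (suc k)) (paths-cong a≈ b≈ c≈ n (suc k))))
    (*-cong (c≈ (suc k)) (paths-cong a≈ b≈ c≈ n (suc (suc k))))

  module FirstPassage (a b c : ℕ → Carrier) where
    open Motzkin a b c public
    module Lifted = Motzkin (a ∘ suc) (b ∘ suc) (c ∘ suc)

    first-arrival : ℕ → Series R
    first-arrival k r = a 1 * Lifted.paths r k

    -- A path from height k + 1 splits at its first arrival at height 0.
    paths-suc-suc : ∀ n k → paths (suc n) (suc k) ≈ (excursion ⊛ first-arrival k) n
    paths-suc-suc zero zero =
      solve 3 (λ a1 b1 c1 → ((a1 :* :1) :+ (b1 :* :0)) :+ (c1 :* :0) := :0 :+ (:1 :* (a1 :* :1))) refl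
        (a 1) (b 1) (c 1)
    paths-suc-suc zero (suc k) =
      solve 4 (λ x y z a1 → ((x :* :0) :+ (y :* :0)) :+ (z :* :0) := :0 :+ (:1 :* (a1 :* :0))) refl
        (a (2 ℕ.+ k)) (b (2 ℕ.+ k)) (c (2 ℕ.+ k)) (a 1)
    paths-suc-suc (suc n) zero = begin
      a 1 * excursion (suc n) + b 1 * paths (suc n) 1 + c 1 * paths (suc n) 2
        ≈⟨ +-cong (+-congˡ (*-congˡ (paths-suc-suc n 0))) (*-congˡ (paths-suc-suc n 1)) ⟩
      a 1 * excursion (suc n) + b 1 * (excursion ⊛ first-arrival 0) n + c 1 * (excursion ⊛ first-arrival 1) n
        ≈⟨ solve 6 (λ a1 b1 c1 X U V → ((a1 :* X) :+ (b1 :* U)) :+ (c1 :* V) := ((b1 :* U) :+ (c1 :* V)) :+ (X :* (a1 :* :1))) refl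
             (a 1) (b 1) (c 1) (excursion (suc n)) _ _ ⟩
      b 1 * (excursion ⊛ first-arrival 0) n + c 1 * (excursion ⊛ first-arrival 1) n + excursion (suc n) * (a 1 * 1#)
        ≈⟨ +-congʳ (⊛-linear₂ excursion (b 1) (c 1) (first-arrival 0) (first-arrival 1) n) ⟨
      (excursion ⊛ (λ r → b 1 * first-arrival 0 r + c 1 * first-arrival 1 r)) n + excursion (suc n) * (a 1 * 1#)
        ≈⟨ +-congʳ (⊛-congᵇ n (λ _ _ → refl) (λ r _ → distribute (Lifted.paths r 0) (Lifted.paths r 1))) ⟨
      (excursion ⊛ (first-arrival 0 ∘ suc)) n + excursion (suc n) * first-arrival 0 0
        ≈⟨ ⊛-last excursion (first-arrival 0) n ⟨
      (excursion ⊛ first-arrival 0) (suc n) ∎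
      where
      distribute : ∀ A B → a 1 * (b 1 * A + c 1 * B) ≈ b 1 * (a 1 * A) + c 1 * (a 1 * B)
      distribute = solve 5 (λ a1 b1 c1 A B → a1 :* ((b1 :* A) :+ (c1 :* B)) := (b1 :* (a1 :* A)) :+ (c1 :* (a1 :* B))) refl
        (a 1) (b 1) (c 1)
    paths-suc-suc (suc n) (suc k) = begin
      x * paths (suc n) (suc k) + y * paths (suc n) (2 ℕ.+ k) + z * paths (suc n) (3 ℕ.+ k)
        ≈⟨ +-cong (+-cong (*-congˡ (paths-suc-suc n k)) (*-congˡ (paths-suc-suc n (suc k))))
                  (*-congˡ (paths-suc-suc n (2 ℕ.+ k))) ⟩
      x * (excursion ⊛ first-arrival k) n + y * (excursion ⊛ first-arrival (suc k)) n
        + z * (excursion ⊛ first-arrival (2 ℕ.+ k)) n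
        ≈⟨ solve 8 (λ x y z U V W X a1 → ((x :* U) :+ (y :* V)) :+ (z :* W) := (((x :* U) :+ (y :* V)) :+ (z :* W)) :+ (X :* (a1 :* :0))) refl
             x y z _ _ _ (excursion (suc n)) (a 1) ⟩
      x * (excursion ⊛ first-arrival k) n + y * (excursion ⊛ first-arrival (suc k)) n
        + z * (excursion ⊛ first-arrival (2 ℕ.+ k)) n + excursion (suc n) * (a 1 * 0#)
        ≈⟨ +-congʳ (⊛-linear₃ excursion x y z (first-arrival k) (first-arrival (suc k)) (first-arrival (2 ℕ.+ k)) n) ⟨
      (excursion ⊛ (λ r → x * first-arrival k r + y * first-arrival (suc k) r + z * first-arrival (2 ℕ.+ k) r)) n
        + excursion (suc n) * (a 1 * 0#)
        ≈⟨ +-congʳ (⊛-congᵇ n (λ _ _ → refl) (λ r _ → distribute (Lifted.paths r k) (Lifted.paths r (suc k)) (Lifted.paths r (2 ℕ.+ k)))) ⟨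
      (excursion ⊛ (first-arrival (suc k) ∘ suc)) n + excursion (suc n) * first-arrival (suc k) 0
        ≈⟨ ⊛-last excursion (first-arrival (suc k)) n ⟨
      (excursion ⊛ first-arrival (suc k)) (suc n) ∎
      where
      x y z : Carrier
      x = a (2 ℕ.+ k)
      y = b (2 ℕ.+ k)
      z = c (2 ℕ.+ k)
      distribute : ∀ A B C → a 1 * (x * A + y * B + z * C) ≈ x * (a 1 * A) + y * (a 1 * B) + z * (a 1 * C)
      distribute = solve 7 (λ a1 x y z A B C → a1 :* (((x :* A) :+ (y :* B)) :+ (z :* C)) := ((x :* (a1 :* A)) :+ (y :* (a1 :* B))) :+ (z :* (a1 :* C))) refl
        (a 1) x y z

    returns : Series R
    returns zero = 0#
    returns (suc zero) = b 0
    returns (suc (suc i)) = c 0 * first-arrival 0 i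

    excursion-fixpoint : ∀ m → excursion m ≈ oneS R m + (returns ⊛ excursion) m
    excursion-fixpoint zero = solve 0 (:1 := :1 :+ (:0 :+ (:0 :* :1))) refl
    excursion-fixpoint (suc zero) =
      solve 2 (λ b0 c0 → (b0 :* :1) :+ (c0 :* :0) := :0 :+ ((:0 :+ (:0 :* ((b0 :* :1) :+ (c0 :* :0)))) :+ (b0 :* :1))) refl
        (b 0) (c 0)
    excursion-fixpoint (suc (suc n)) = begin
      b 0 * excursion (suc n) + c 0 * paths (suc n) 1
        ≈⟨ +-congˡ (*-congˡ (paths-suc-suc n 0)) ⟩
      b 0 * excursion (suc n) + c 0 * (excursion ⊛ first-arrival 0) n
        ≈⟨ solve 5 (λ b0 c0 X Y Φ → (b0 :* X) :+ (c0 :* Φ) := :0 :+ ((:0 :* Y) :+ ((b0 :* X) :+ (c0 :* Φ)))) refl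
             (b 0) (c 0) (excursion (suc n)) (excursion (suc (suc n))) _ ⟩
      0# + (0# * excursion (suc (suc n)) + (b 0 * excursion (suc n) + c 0 * (excursion ⊛ first-arrival 0) n))
        ≈⟨ +-congˡ (trans (⊛-first returns excursion (suc n)) (+-congˡ (trans (⊛-first (returns ∘ suc) excursion n)
             (+-congˡ (trans (⊛-comm _ excursion n) (⊛-*ʳ excursion (c 0) (first-arrival 0) n)))))) ⟨
      oneS R (suc (suc n)) + (returns ⊛ excursion) (suc (suc n)) ∎

  module JFraction (bj lj a b c : ℕ → Carrier)
                   (bj≈b : ∀ h → bj h ≈ b h) (lj≈ac : ∀ h → lj (suc h) ≈ a (suc h) * c h) where

    shift : ℕ → (ℕ → Carrier) → ℕ → Carrier
    shift h f k = f (h ℕ.+ k)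

    module Level (h : ℕ) = FirstPassage (shift h a) (shift h b) (shift h c)

    -- The series b_h z + λ_(h+1) z² J_d(h+1) that jfracTrunc inverts (local to its where-block in Defs).
    jfracStep : ℕ → ℕ → Series R
    jfracStep d h zero = 0#
    jfracStep d h (suc zero) = bj h
    jfracStep d h (suc (suc i)) = lj (suc h) * jfracTrunc R bj lj d (suc h) i

    jfracTrunc-fixpoint : ∀ d h m →
      jfracTrunc R bj lj (suc d) h m ≈ oneS R m + (jfracStep d h ⊛ jfracTrunc R bj lj (suc d) h) m
    jfracTrunc-fixpoint d h m = trans (inv1m-fixpoint refl m) (+-congˡ (⊛-congᵇ {g = S} {g′ = S} m
      (λ { zero _ → refl ; (suc zero) _ → refl ; (suc (suc i)) _ → refl }) (λ _ _ → refl)))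
      where
      S : Series R
      S = jfracTrunc R bj lj (suc d) h

    -- Both sides solve S = 1 + g ⊛ S, with the same g up to z^(2d) by induction on the depth d.
    jfracTrunc≈excursion : ∀ d h m → m ≤ d ℕ.+ d → jfracTrunc R bj lj d h m ≈ Level.excursion h m
    jfracTrunc≈excursion zero h zero z≤n = refl
    jfracTrunc≈excursion (suc d) h = fixpoint-unique (suc d ℕ.+ suc d) refl steps≈
      (λ m _ → jfracTrunc-fixpoint d h m) (λ m _ → Level.excursion-fixpoint h m)
      where
      steps≈ : ∀ i → i ≤ suc d ℕ.+ suc d → jfracStep d h i ≈ Level.returns h i
      steps≈ zero _ = refl
      steps≈ (suc zero) _ = trans (bj≈b h) (reflexive (≡.cong b (≡.sym (ℕ.+-identityʳ h))))
      steps≈ (suc (suc i)) (s≤s 1+i≤d+[1+d]) = begin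
        lj (suc h) * jfracTrunc R bj lj d (suc h) i
          ≈⟨ *-cong (lj≈ac h) (jfracTrunc≈excursion d (suc h) i i≤d+d) ⟩
        a (suc h) * c h * Level.excursion (suc h) i
          ≈⟨ *-cong (*-cong (reflexive (≡.cong a (ℕ.+-comm 1 h))) (reflexive (≡.cong c (≡.sym (ℕ.+-identityʳ h)))))
                    (paths-cong (shift-suc {a}) (shift-suc {b}) (shift-suc {c}) i 0) ⟩
        shift h a 1 * shift h c 0 * Level.Lifted.paths h i 0
          ≈⟨ trans (*-assoc _ _ _) (x∙yz≈y∙xz _ _ _) ⟩
        shift h c 0 * (shift h a 1 * Level.Lifted.paths h i 0) ∎
        where
        i≤d+d : i ≤ d ℕ.+ d
        i≤d+d = ℕ.≤-pred (ℕ.≤-trans 1+i≤d+[1+d] (ℕ.≤-reflexive (ℕ.+-suc d d)))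
        shift-suc : ∀ {f} k → shift (suc h) f k ≈ shift h f (suc k)
        shift-suc {f} k = reflexive (≡.cong f (≡.sym (ℕ.+-suc h k)))

  jfracCoeff≈paths : ∀ {bj lj a b c} → (∀ h → bj h ≈ b h) → (∀ h → lj (suc h) ≈ a (suc h) * c h) →
                     ∀ n → jfracCoeff R bj lj n ≈ Motzkin.paths a b c n 0
  jfracCoeff≈paths {bj} {lj} {a} {b} {c} bj≈b lj≈ac n =
    JFraction.jfracTrunc≈excursion bj lj a b c bj≈b lj≈ac (suc n) 0 n
      (ℕ.≤-trans (ℕ.n≤1+n n) (ℕ.m≤m+n (suc n) (suc n)))

  -- The three-term relation of the q-Taylor functionals

  module ThreeTerm (q t E : Carrier) where

    -- ψ k j = [j choose k]_q t^(j−k), so that ⟪ ψ k ∣ f ⟫ = (D_q^k f)(t) / [k]_q! is the k-th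
    -- q-Taylor coefficient of f at t.
    ψ ψ⁻ : ℕ → ℕ → Carrier
    ψ k (suc j) = ψ⁻ k j + q ^ k * t * ψ k j
    ψ zero zero = 1#
    ψ (suc k) zero = 0#
    ψ⁻ zero j = 0#
    ψ⁻ (suc k) j = ψ k j

    α β γ : ℕ → Carrier
    α k = 1# − E * q ^ k
    β k = t * q ^ k * (1# + E − E * q ^ k − q * E * q ^ k)
    γ k = (1# − q * q ^ k) * (1# + t * t * q * E * q ^ k * q ^ k)

    ρ ρ⁻ : ℕ → ℕ → Carrier
    ρ k j = α k * ψ⁻ k j + β k * ψ k j + γ k * ψ (suc k) j
    ρ⁻ zero j = 0#
    ρ⁻ (suc k) j = ρ k j

    evalP≈⟪ψ₀⟫ : ∀ f → evalP R f t ≈ ⟪ ψ 0 ∣ f ⟫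
    evalP≈⟪ψ₀⟫ [] = refl
    evalP≈⟪ψ₀⟫ (x ∷ f) = +-cong (sym (*-identityʳ x)) (begin
      t * evalP R f t                ≈⟨ *-congˡ (evalP≈⟪ψ₀⟫ f) ⟩
      t * ⟪ ψ 0 ∣ f ⟫                ≈⟨ ⟪⟫-* t (ψ 0) f ⟨
      ⟪ (λ j → t * ψ 0 j) ∣ f ⟫      ≈⟨ ⟪⟫-cong (λ j → trans (+-identityˡ _) (*-congʳ (*-identityˡ t))) f ⟨
      ⟪ ψ 0 ∘ suc ∣ f ⟫              ∎)

    Ŵ-ψ-step : ∀ k j → Ŵ q E (ψ k) (suc j) ≈
               q * (Ŵ q E (ψ⁻ k) j + q ^ k * t * Ŵ q E (ψ k) j) + (1# − q) * (ψ k j + ψ k (suc (suc j)))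
    Ŵ-ψ-step k zero = solve 7 (λ q E t Q a0 a1 p0 → ((:1 :- (q :* :1)) :* p0) :+ ((:1 :- ((q :* E) :* (q :* :1))) :* (a1 :+ ((Q :* t) :* (a0 :+ ((Q :* t) :* p0))))) := (q :* (((:1 :- (q :* E)) :* a1) :+ ((Q :* t) :* ((:1 :- (q :* E)) :* (a0 :+ ((Q :* t) :* p0)))))) :+ ((:1 :- q) :* (p0 :+ (a1 :+ ((Q :* t) :* (a0 :+ ((Q :* t) :* p0))))))) refl
      q E t (q ^ k) (ψ⁻ k 0) (ψ⁻ k 1) (ψ k 0)
    Ŵ-ψ-step k (suc j) = solve 9 (λ q E t Q P a0 a1 a2 p0 → ((:1 :- (q :* (q :* P))) :* (a0 :+ ((Q :* t) :* p0))) :+ ((:1 :- ((q :* E) :* (q :* (q :* P)))) :* (a2 :+ ((Q :* t) :* (a1 :+ ((Q :* t) :* (a0 :+ ((Q :* t) :* p0))))))) := (q :* ((((:1 :- (q :* P)) :* a0) :+ ((:1 :- ((q :* E) :* (q :* P))) :* a2)) :+ ((Q :* t) :* (((:1 :- (q :* P)) :* p0) :+ ((:1 :- ((q :* E) :* (q :* P))) :* (a1 :+ ((Q :* t) :* (a0 :+ ((Q :* t) :* p0))))))))) :+ ((:1 :- q) :* ((a0 :+ ((Q :* t) :* p0)) :+ (a2 :+ ((Q :* t) :* (a1 :+ ((Q :* t) :* (a0 :+ ((Q :* t) :* p0))))))))) refl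
      q E t (q ^ k) (q ^ j) (ψ⁻ k j) (ψ⁻ k (suc j)) (ψ⁻ k (suc (suc j))) (ψ k j)

    ρ-step : ∀ k j → ρ k (suc j) ≈ q * (ρ⁻ k j + q ^ k * t * ρ k j) + (1# − q) * (ψ k j + ψ k (suc (suc j)))
    ρ-step zero j = solve 5 (λ q E t p0 p1 → (((:1 :- (E :* :1)) :* :0) :+ (((t :* :1) :* (((:1 :+ E) :- (E :* :1)) :- ((q :* E) :* :1))) :* (:0 :+ ((:1 :* t) :* p0)))) :+ (((:1 :- (q :* :1)) :* (:1 :+ (((((t :* t) :* q) :* E) :* :1) :* :1))) :* (p0 :+ (((q :* :1) :* t) :* p1))) := (q :* (:0 :+ ((:1 :* t) :* ((((:1 :- (E :* :1)) :* :0) :+ (((t :* :1) :* (((:1 :+ E) :- (E :* :1)) :- ((q :* E) :* :1))) :* p0)) :+ (((:1 :- (q :* :1)) :* (:1 :+ (((((t :* t) :* q) :* E) :* :1) :* :1))) :* p1))))) :+ ((:1 :- q) :* (p0 :+ (:0 :+ ((:1 :* t) :* (:0 :+ ((:1 :* t) :* p0))))))) refl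
      q E t (ψ 0 j) (ψ 1 j)
    ρ-step (suc k) j = solve 8 (λ q E t Q b p p1 p2 → (((:1 :- (E :* (q :* Q))) :* (b :+ ((Q :* t) :* p))) :+ (((t :* (q :* Q)) :* (((:1 :+ E) :- (E :* (q :* Q))) :- ((q :* E) :* (q :* Q)))) :* (p :+ (((q :* Q) :* t) :* p1)))) :+ (((:1 :- (q :* (q :* Q))) :* (:1 :+ (((((t :* t) :* q) :* E) :* (q :* Q)) :* (q :* Q)))) :* (p1 :+ (((q :* (q :* Q)) :* t) :* p2))) := (q :* (((((:1 :- (E :* Q)) :* b) :+ (((t :* Q) :* (((:1 :+ E) :- (E :* Q)) :- ((q :* E) :* Q))) :* p)) :+ (((:1 :- (q :* Q)) :* (:1 :+ (((((t :* t) :* q) :* E) :* Q) :* Q))) :* p1)) :+ (((q :* Q) :* t) :* ((((:1 :- (E :* (q :* Q))) :* p) :+ (((t :* (q :* Q)) :* (((:1 :+ E) :- (E :* (q :* Q))) :- ((q :* E) :* (q :* Q)))) :* p1)) :+ (((:1 :- (q :* (q :* Q))) :* (:1 :+ (((((t :* t) :* q) :* E) :* (q :* Q)) :* (q :* Q)))) :* p2))))) :+ ((:1 :- q) :* (p1 :+ ((b :+ ((Q :* t) :* p)) :+ (((q :* Q) :* t) :* (p :+ (((q :* Q) :* t) :* p1))))))) refl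
      q E t (q ^ k) (ψ⁻ k j) (ψ k j) (ψ (suc k) j) (ψ (suc (suc k)) j)

    three-term-base : ∀ k → Ŵ q E (ψ k) 0 ≈ ρ k 0
    three-term-base zero = solve 3 (λ q E t → (:1 :- (q :* E)) :* (:0 :+ ((:1 :* t) :* :1)) := (((:1 :- (E :* :1)) :* :0) :+ (((t :* :1) :* (((:1 :+ E) :- (E :* :1)) :- ((q :* E) :* :1))) :* :1)) :+ (((:1 :- (q :* :1)) :* (:1 :+ (((((t :* t) :* q) :* E) :* :1) :* :1))) :* :0)) refl
      q E t
    three-term-base (suc zero) = solve 5 (λ q E t b c → (:1 :- (q :* E)) :* (:1 :+ (((q :* :1) :* t) :* :0)) := (((:1 :- (E :* (q :* :1))) :* :1) :+ (b :* :0)) :+ (c :* :0)) refl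
      q E t (β 1) (γ 1)
    three-term-base (suc (suc k)) = solve 7 (λ q E t Q a b c → (:1 :- (q :* E)) :* (:0 :+ ((Q :* t) :* :0)) := ((a :* :0) :+ (b :* :0)) :+ (c :* :0)) refl
      q E t (q ^ suc (suc k)) (α (suc (suc k))) (β (suc (suc k))) (γ (suc (suc k)))

    Ŵ-zero : ∀ j → Ŵ q E (λ _ → 0#) j ≈ 0#
    Ŵ-zero zero = zeroʳ _
    Ŵ-zero (suc j) = trans (+-cong (zeroʳ _) (zeroʳ _)) (+-identityʳ 0#)

    three-term : ∀ j k → Ŵ q E (ψ k) j ≈ ρ k j
    three-term zero k = three-term-base k
    three-term (suc j) k = begin
      Ŵ q E (ψ k) (suc j)
        ≈⟨ Ŵ-ψ-step k j ⟩
      q * (Ŵ q E (ψ⁻ k) j + q ^ k * t * Ŵ q E (ψ k) j) + (1# − q) * (ψ k j + ψ k (suc (suc j)))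
        ≈⟨ +-congʳ (*-congˡ (+-cong (lower k) (*-congˡ (three-term j k)))) ⟩
      q * (ρ⁻ k j + q ^ k * t * ρ k j) + (1# − q) * (ψ k j + ψ k (suc (suc j)))
        ≈⟨ ρ-step k j ⟨
      ρ k (suc j) ∎
      where
      lower : ∀ k → Ŵ q E (ψ⁻ k) j ≈ ρ⁻ k j
      lower zero = Ŵ-zero j
      lower (suc k) = three-term j k

    -- The certificates expand with a⁻¹ a = 1 + (a a⁻¹ − 1) and a² = −qE + (a² + qE).
    module _ {a a⁻¹ : Carrier} (aa⁻¹≈1 : a * a⁻¹ ≈ 1#) (aa≈-qE : a * a ≈ - (q * E)) where

      bseq≈β : ∀ h → bseq R q a a⁻¹ (- a) t h ≈ β h
      bseq≈β zero = lincomb₂ (- a + t + a * a * t) t aa⁻¹≈1 aa≈-qE (solve 5 (λ q E t a ai → ((a :+ ai) :- (ai :* ((:1 :- ((a :* (:- a)) :* :1)) :* (:1 :- ((a :* t) :* :1))))) :- (a :* ((:1 :- :1) :* (:1 :- (((:- a) :* t) :* :1)))) := (((t :* :1) :* (((:1 :+ E) :- (E :* :1)) :- ((q :* E) :* :1))) :+ ((((:- a) :+ t) :+ ((a :* a) :* t)) :* ((a :* ai) :- :1))) :+ (t :* ((a :* a) :- (:- (q :* E))))) refl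
        q E t a a⁻¹)
      bseq≈β (suc h) = lincomb₂ (- a * qʰ⁺¹ + t * qʰ⁺¹ + a * a * t * qʰ⁺¹ * qʰ⁺¹) (t * (qʰ⁺¹ * qʰ⁺¹ − qʰ + qʰ⁺¹ * qʰ)) aa⁻¹≈1 aa≈-qE
        (solve 6 (λ q E t a ai Q → ((a :+ ai) :- (ai :* ((:1 :- ((a :* (:- a)) :* (q :* Q))) :* (:1 :- ((a :* t) :* (q :* Q)))))) :- (a :* ((:1 :- (q :* Q)) :* (:1 :- (((:- a) :* t) :* Q)))) := (((t :* (q :* Q)) :* (((:1 :+ E) :- (E :* (q :* Q))) :- ((q :* E) :* (q :* Q)))) :+ (((((:- a) :* (q :* Q)) :+ (t :* (q :* Q))) :+ ((((a :* a) :* t) :* (q :* Q)) :* (q :* Q))) :* ((a :* ai) :- :1))) :+ ((t :* ((((q :* Q) :* (q :* Q)) :- Q) :+ ((q :* Q) :* Q))) :* ((a :* a) :- (:- (q :* E))))) refl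
          q E t a a⁻¹ qʰ)
        where
        qʰ qʰ⁺¹ : Carrier
        qʰ = q ^ h
        qʰ⁺¹ = q * qʰ

      -- lseq (suc h) = (a⁻¹ a) X(a²) with X(x) = (1 + x qʰ)(1 − x t² q²ʰ)(1 − qʰ⁺¹), so the cofactors
      -- are X(a²) and the divided difference (X(a²) − X(−qE)) / (a² + qE).
      lseq≈αγ : ∀ h → lseq R q a a⁻¹ (- a) t (suc h) ≈ α (suc h) * γ h
      lseq≈αγ h = lincomb₂
        ((1# + a * a * qʰ) * (1# − a * a * t * t * qʰ * qʰ) * (1# − q * qʰ))
        ((qʰ − t * t * qʰ * qʰ − (a * a − q * E) * qʰ * t * t * qʰ * qʰ) * (1# − q * qʰ)) aa⁻¹≈1 aa≈-qE
        (solve 6 (λ q E t a ai Q → (ai :* ((:1 :- ((a :* (:- a)) :* Q)) :* (:1 :- ((a :* t) :* Q)))) :* (a :* ((:1 :- (q :* Q)) :* (:1 :- (((:- a) :* t) :* Q)))) := (((:1 :- (E :* (q :* Q))) :* ((:1 :- (q :* Q)) :* (:1 :+ (((((t :* t) :* q) :* E) :* Q) :* Q)))) :+ ((((:1 :+ ((a :* a) :* Q)) :* (:1 :- (((((a :* a) :* t) :* t) :* Q) :* Q))) :* (:1 :- (q :* Q))) :* ((a :* ai) :- :1))) :+ ((((Q :- (((t :* t) :* Q) :* Q)) :- (((((((a :* a) :- (q :* E)) :* Q) :* t) :* t) :* Q) :* Q)) :* (:1 :- (q :* Q))) :* ((a :* a) :- (:- (q :* E))))) refl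
          q E t a a⁻¹ qʰ)
        where
        qʰ : Carrier
        qʰ = q ^ h

    module Iterates (W : Poly R → Poly R) (W-transpose : ∀ c f → (1# − q) * ⟪ c ∣ W f ⟫ ≈ ⟪ Ŵ q E c ∣ f ⟫) where

      G : ℕ → ℕ → Carrier
      G n k = ⟪ ψ k ∣ iter R W n (one R) ⟫

      G-step : ∀ n k → (1# − q) ^ suc n * G (suc n) k ≈
               (1# − q) ^ n * (α k * ⟪ ψ⁻ k ∣ iter R W n (one R) ⟫ + β k * G n k + γ k * G n (suc k))
      G-step n k = begin
        (1# − q) * P * ⟪ ψ k ∣ W f ⟫    ≈⟨ trans (*-congʳ (*-comm _ P)) (*-assoc P _ _) ⟩
        P * ((1# − q) * ⟪ ψ k ∣ W f ⟫)  ≈⟨ *-congˡ (W-transpose (ψ k) f) ⟩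
        P * ⟪ Ŵ q E (ψ k) ∣ f ⟫         ≈⟨ *-congˡ (⟪⟫-cong (λ j → three-term j k) f) ⟩
        P * ⟪ ρ k ∣ f ⟫                 ≈⟨ *-congˡ (⟪⟫-linear₃ (α k) (β k) (γ k) (ψ⁻ k) (ψ k) (ψ (suc k)) f) ⟩
        P * (α k * ⟪ ψ⁻ k ∣ f ⟫ + β k * G n k + γ k * G n (suc k)) ∎
        where
        P : Carrier
        P = (1# − q) ^ n
        f : Poly R
        f = iter R W n (one R)

      paths≈G : ∀ n k → Motzkin.paths α β γ n k ≈ (1# − q) ^ n * G n k
      paths≈G zero zero = solve 0 (:1 := :1 :* ((:1 :* :1) :+ :0)) refl
      paths≈G zero (suc k) = solve 0 (:0 := :1 :* ((:1 :* :0) :+ :0)) refl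
      paths≈G (suc n) zero = begin
        β 0 * paths n 0 + γ 0 * paths n 1
          ≈⟨ +-cong (*-congˡ (paths≈G n 0)) (*-congˡ (paths≈G n 1)) ⟩
        β 0 * (P * G n 0) + γ 0 * (P * G n 1)
          ≈⟨ lincomb₁ (- (P * α 0)) (⟪⟫-zero f)
               (solve 7 (λ x y z P Z B C → (y :* (P :* B)) :+ (z :* (P :* C)) := (P :* (((x :* Z) :+ (y :* B)) :+ (z :* C))) :+ ((:- (P :* x)) :* (Z :- :0))) refl
                 (α 0) (β 0) (γ 0) P ⟪ ψ⁻ 0 ∣ f ⟫ (G n 0) (G n 1)) ⟩
        P * (α 0 * ⟪ ψ⁻ 0 ∣ f ⟫ + β 0 * G n 0 + γ 0 * G n 1)
          ≈⟨ G-step n 0 ⟨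
        (1# − q) ^ suc n * G (suc n) 0 ∎
        where
        open Motzkin α β γ using (paths)
        P : Carrier
        P = (1# − q) ^ n
        f : Poly R
        f = iter R W n (one R)
      paths≈G (suc n) (suc k) = begin
        α (suc k) * paths n k + β (suc k) * paths n (suc k) + γ (suc k) * paths n (suc (suc k))
          ≈⟨ +-cong (+-cong (*-congˡ (paths≈G n k)) (*-congˡ (paths≈G n (suc k)))) (*-congˡ (paths≈G n (suc (suc k)))) ⟩
        α (suc k) * (P * G n k) + β (suc k) * (P * G n (suc k)) + γ (suc k) * (P * G n (suc (suc k)))
          ≈⟨ solve 7 (λ x y z P A B C → ((x :* (P :* A)) :+ (y :* (P :* B))) :+ (z :* (P :* C)) := P :* (((x :* A) :+ (y :* B)) :+ (z :* C))) refl
               (α (suc k)) (β (suc k)) (γ (suc k)) P (G n k) (G n (suc k)) (G n (suc (suc k))) ⟩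
        P * (α (suc k) * G n k + β (suc k) * G n (suc k) + γ (suc k) * G n (suc (suc k)))
          ≈⟨ G-step n (suc k) ⟨
        (1# − q) ^ suc n * G (suc n) (suc k) ∎
        where
        open Motzkin α β γ using (paths)
        P : Carrier
        P = (1# − q) ^ n

  moment-formula : ∀ {q t E a a⁻¹ u} (W : Poly R → Poly R) →
                   (∀ c f → (1# − q) * ⟪ c ∣ W f ⟫ ≈ ⟪ Ŵ q E c ∣ f ⟫) →
                   a * a⁻¹ ≈ 1# → a * a ≈ - (q * E) → (1# − q) * u ≈ 1# →
                   ∀ n → evalP R (iter R W n (one R)) t ≈ mu R q a a⁻¹ (- a) t n * u ^ n
  moment-formula {q} {t} {E} {a} {a⁻¹} {u} W W-transpose aa⁻¹≈1 aa≈-qE [1-q]u≈1 n = begin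
    evalP R f t                      ≈⟨ evalP≈⟪ψ₀⟫ f ⟩
    G n 0                            ≈⟨ *-identityʳ _ ⟨
    G n 0 * 1#                       ≈⟨ *-congˡ (^-inverse [1-q]u≈1 n) ⟨
    G n 0 * ((1# − q) ^ n * u ^ n)   ≈⟨ x∙yz≈y∙xz _ _ _ ⟩
    (1# − q) ^ n * (G n 0 * u ^ n)   ≈⟨ *-assoc _ _ _ ⟨
    (1# − q) ^ n * G n 0 * u ^ n     ≈⟨ *-congʳ (paths≈G n 0) ⟨
    Motzkin.paths α β γ n 0 * u ^ n  ≈⟨ *-congʳ (jfracCoeff≈paths (bseq≈β aa⁻¹≈1 aa≈-qE) (lseq≈αγ aa⁻¹≈1 aa≈-qE) n) ⟨
    mu R q a a⁻¹ (- a) t n * u ^ n   ∎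
    where
    open ThreeTerm q t E
    open Iterates W W-transpose
    f : Poly R
    f = iter R W n (one R)

proposition2p7 : ∀ {c ℓ} (R : CommutativeRing c ℓ) →
    let open CommutativeRing R in
    ∀ (i s sinv t q u : Carrier) →
    i * i ≈ - 1# →
    s * sinv ≈ 1# →
    q ≈ s * s →
    (1# + (- q)) * u ≈ 1# →
    ∀ (n : ℕ) →
      (Q R n t q ≈ mu R q (i * s) (- (i * sinv)) (- (i * s)) t n * pow R u n)
      × (Rn R n t q ≈ mu R q (i * q) (- (i * (sinv * sinv))) (- (i * q)) t n * pow R u n)
proposition2p7 R i s sinv t q u i²≈-1 s·sinv≈1 q≈s² [1-q]u≈1 n =
    moment-formula (D+UDU q) (D+UDU-transpose q) is·is⁻¹≈1 is·is≈-q [1-q]u≈1 n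
  , moment-formula (D+DUU q) (D+DUU-transpose q) iq·iq⁻¹≈1 iq·iq≈-q² [1-q]u≈1 n
  where
  open CommutativeRing R
  open Moments R
  open ℤ-CoefficientSolver R using (solve; _:=_; _:+_; _:-_; :-_; _:*_; :1)
  is·is⁻¹≈1 : i * s * - (i * sinv) ≈ 1#
  is·is⁻¹≈1 = lincomb₂ (- (s * sinv)) 1# i²≈-1 s·sinv≈1
    (solve 3 (λ i s si → (i :* s) :* (:- (i :* si)) := (:1 :+ ((:- (s :* si)) :* ((i :* i) :- (:- :1)))) :+ (:1 :* ((s :* si) :- :1))) refl
      i s sinv)
  is·is≈-q : i * s * (i * s) ≈ - (q * 1#)
  is·is≈-q = lincomb₂ (s * s) 1# i²≈-1 q≈s²
    (solve 3 (λ i s q → (i :* s) :* (i :* s) := ((:- (q :* :1)) :+ ((s :* s) :* ((i :* i) :- (:- :1)))) :+ (:1 :* (q :- (s :* s)))) refl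
      i s q)
  iq·iq⁻¹≈1 : i * q * - (i * (sinv * sinv)) ≈ 1#
  iq·iq⁻¹≈1 = lincomb₃ (- (q * sinv * sinv)) (sinv * sinv) (s * sinv + 1#) i²≈-1 q≈s² s·sinv≈1
    (solve 4 (λ i s si q → (i :* q) :* (:- (i :* (si :* si))) := ((:1 :+ ((:- ((q :* si) :* si)) :* ((i :* i) :- (:- :1)))) :+ ((si :* si) :* (q :- (s :* s)))) :+ (((s :* si) :+ :1) :* ((s :* si) :- :1))) refl
      i s sinv q)
  iq·iq≈-q² : i * q * (i * q) ≈ - (q * q)
  iq·iq≈-q² = lincomb₁ (q * q) i²≈-1
    (solve 2 (λ i q → (i :* q) :* (i :* q) := (:- (q :* q)) :+ ((q :* q) :* ((i :* i) :- (:- :1)))) refl i q)
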